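{- Let $n\geq 2$. Every vertex of $\overline{\Gamma}_n$ has degree $n$, $n-1$ or $n-2$. The number of vertices of degree $n-2$ is $|E(\Gamma_{n-1})|$, the number of vertices of degree $n-1$ is $|E(\Gamma_{n-2})|$, and the number of vertices of degree $n$ is $\sum_{k=0}^{n-4}2^k|E(\Gamma_{n-k-3})|$.
   Context: The hypercube $Q_n$ has vertex set the binary strings of length $n$, adjacency meaning differing in exactly one position. $\Gamma_m$ (Fibonacci cube) is the subgraph of $Q_m$ induced by binary strings of length $m$ with no two consecutive 1's ($\Gamma_0=K_1$). $\overline{\Gamma}_n$ is the subgraph of $Q_n$ induced by the binary strings of length $n$ containing $11$ as a substring; degrees are taken in $\overline{\Gamma}_n$. Empty sums are $0$. -}

module Defs where

open import Data.Bool using (Bool; true; false; _∧_; _∨_; not; T)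
open import Data.Nat using (ℕ; zero; suc; _+_; _*_; _^_; _≡ᵇ_)
open import Data.Vec using (Vec; []; _∷_)
open import Data.List using (List; []; _∷_; map; _++_; length; filterᵇ; cartesianProduct; upTo)
open import Data.Nat.ListAction using (sum)
open import Data.Product using (_×_; _,_)

-- all binary strings of length n (true = 1, false = 0)
allStrings : (n : ℕ) → List (Vec Bool n)
allStrings zero = [] ∷ []
allStrings (suc n) = map (false ∷_) (allStrings n) ++ map (true ∷_) (allStrings n)

hamming : {n : ℕ} → Vec Bool n → Vec Bool n → ℕ
hamming [] [] = 0
hamming (a ∷ u) (b ∷ v) = (if a xorB b then 1 else 0) + hamming u v
  where
    if_then_else_ : {A : Set} → Bool → A → A → A
    if true then x else _ = x
    if false then _ else y = y
    _xorB_ : Bool → Bool → Bool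
    true xorB b' = not b'
    false xorB b' = b'

adjQ : {n : ℕ} → Vec Bool n → Vec Bool n → Bool
adjQ u v = hamming u v ≡ᵇ 1

has11 : {n : ℕ} → Vec Bool n → Bool
has11 [] = false
has11 (a ∷ []) = false
has11 (a ∷ b ∷ u) = (a ∧ b) ∨ has11 (b ∷ u)

fib : {n : ℕ} → Vec Bool n → Bool
fib u = not (has11 u)

-- strict lexicographic order on strings (used to count each unordered edge once)
lexLt : {n : ℕ} → Vec Bool n → Vec Bool n → Bool
lexLt [] [] = false
lexLt (false ∷ u) (true ∷ v) = true
lexLt (true ∷ u) (false ∷ v) = false
lexLt (false ∷ u) (false ∷ v) = lexLt u v
lexLt (true ∷ u) (true ∷ v) = lexLt u v

-- |E(Γ_m)|: number of unordered pairs {u,v} of Fibonacci strings of length m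
-- adjacent in Q_m (each pair counted once, via u <lex v)
edgesFib : ℕ → ℕ
edgesFib m = length (filterᵇ ok (cartesianProduct (allStrings m) (allStrings m)))
  where
    ok : Vec Bool m × Vec Bool m → Bool
    ok (u , v) = fib u ∧ fib v ∧ adjQ u v ∧ lexLt u v

vertsBar : (n : ℕ) → List (Vec Bool n)
vertsBar n = filterᵇ has11 (allStrings n)

degBar : {n : ℕ} → Vec Bool n → ℕ
degBar {n} u = length (filterᵇ (adjQ u) (vertsBar n))

countDeg : ℕ → ℕ → ℕ
countDeg n d = length (filterᵇ (λ u → degBar u ≡ᵇ d) (vertsBar n))

-- Σ_{k=0}^{K-1} f k   (empty when K = 0)
sumBelow : ℕ → (ℕ → ℕ) → ℕ
sumBelow K f = sum (map f (upTo K))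

module Submission where

-- Flipping a 0 of a string that contains 11 keeps a 11, so its degree in Γ̄_n is n minus the
-- number of critical 1s, those whose flip destroys every 11.  Critical 1s exist only when the
-- runs of 1s of length at least 2 reduce to a single run of length exactly 2 (both of its 1s are
-- critical: degree n − 2) or exactly 3 (its middle 1: degree n − 1).  A ten-state automaton,
-- reading a string from the right, records this kind of the string together with how it
-- starts; the degree formula follows by induction along it, and the numbers of strings in each
-- state obey a linear recurrence.
--
-- Contracting the unique run to a single marked 1 turns the strings of degree n − 2 (resp.
-- n − 1) into Fibonacci strings of length n − 1 (resp. n − 2) with one marked 1.  So does
-- sending an edge of Γ_m to its lexicographically larger end, marking the flipped 1.  Both
-- counts satisfy w(m+2) = w(m+1) + w(m) + F(m), with F(m) the number of Fibonacci strings of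
-- length m.  Finally, a string of degree n keeps degree n when either letter is prepended, and
-- the other strings of degree n + 1 arise by prepending 1; there are w(n − 2) of them, which
-- produces the geometric sum.

open import Defs
open import Data.Bool using (Bool; true; false; T; _∧_; not)
open import Data.Bool.Properties using (∧-zeroʳ; ∧-comm; ∧-assoc)
open import Data.Empty using (⊥-elim)
open import Data.Nat using (ℕ; zero; suc; _+_; _*_; _∸_; _^_; _≤_; _≡ᵇ_; s≤s; z≤n)
open import Data.Nat.Properties
  using ( ≡ᵇ⇒≡; ≡⇒≡ᵇ; +-commutativeSemigroup; +-identityʳ; +-comm; +-assoc; +-suc; *-suc; *-assoc
        ; *-zeroʳ; *-distribˡ-+; m≤n+m; m+n∸n≡m; ≤-trans; ∸-cancelˡ-≡; ∸-+-assoc )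
open import Data.Nat.Tactic.RingSolver using (solve-∀)
open import Algebra.Properties.CommutativeSemigroup +-commutativeSemigroup using (interchange)
open import Data.Nat.ListAction using (sum)
open import Data.Nat.ListAction.Properties using (sum-++)
open import Data.List using (List; []; _∷_; map; _++_; length; filterᵇ; cartesianProduct; upTo)
open import Data.List.Properties using (map-++; map-∘; map-cong; map-applyUpTo)
open import Data.Vec using (Vec; []; _∷_)
open import Data.Product using (Σ; _×_; _,_; proj₁)
open import Data.Sum using (_⊎_; inj₁; inj₂)
import Data.Sum as Sum
open import Function using (_∘_)
open import Relation.Binary.PropositionalEquality

open ≡-Reasoning

toℕ : Bool → ℕ
toℕ false = 0
toℕ true = 1

toℕ-T : ∀ {b} → T b → toℕ b ≡ 1
toℕ-T {true} _ = refl

∧-congʳ-T : ∀ {a b} c → (T c → a ≡ b) → a ∧ c ≡ b ∧ c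
∧-congʳ-T {a} {b} false _ = trans (∧-zeroʳ a) (sym (∧-zeroʳ b))
∧-congʳ-T true a≡b = cong (_∧ true) (a≡b _)

∸-≡ᵇ-∸ : ∀ {n a b} → a ≤ n → b ≤ n → (n ∸ a ≡ᵇ n ∸ b) ≡ (a ≡ᵇ b)
∸-≡ᵇ-∸ {n} {a} {b} a≤n b≤n with n ∸ a ≡ᵇ n ∸ b in e₁ | a ≡ᵇ b in e₂
... | true  | true  = refl
... | false | false = refl
... | true  | false = ⊥-elim (subst T e₂ (≡⇒≡ᵇ a b (∸-cancelˡ-≡ a≤n b≤n (≡ᵇ⇒≡ _ _ (subst T (sym e₁) _)))))
... | false | true  = ⊥-elim (subst T e₁ (≡⇒≡ᵇ _ _ (cong (n ∸_) (≡ᵇ⇒≡ a b (subst T (sym e₂) _)))))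

module _ {A : Set} where

  sum-map-+ : (f g : A → ℕ) (xs : List A) → sum (map (λ x → f x + g x) xs) ≡ sum (map f xs) + sum (map g xs)
  sum-map-+ f g [] = refl
  sum-map-+ f g (x ∷ xs) =
    trans (cong (f x + g x +_) (sum-map-+ f g xs)) (interchange (f x) (g x) (sum (map f xs)) (sum (map g xs)))

  sum-map-zero : (xs : List A) → sum (map (λ _ → 0) xs) ≡ 0
  sum-map-zero [] = refl
  sum-map-zero (_ ∷ xs) = sum-map-zero xs

  sum-map-*ˡ : (c : ℕ) (f : A → ℕ) (xs : List A) → sum (map (λ x → c * f x) xs) ≡ c * sum (map f xs)
  sum-map-*ˡ c f [] = sym (*-zeroʳ c)
  sum-map-*ˡ c f (x ∷ xs) = trans (cong (c * f x +_) (sum-map-*ˡ c f xs)) (sym (*-distribˡ-+ c (f x) _))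

  length-filterᵇ : (p : A → Bool) (xs : List A) → length (filterᵇ p xs) ≡ sum (map (toℕ ∘ p) xs)
  length-filterᵇ p [] = refl
  length-filterᵇ p (x ∷ xs) with p x
  ... | true  = cong suc (length-filterᵇ p xs)
  ... | false = length-filterᵇ p xs

  length-filterᵇ² : (p q : A → Bool) (xs : List A) →
                    length (filterᵇ p (filterᵇ q xs)) ≡ sum (map (λ x → toℕ (p x ∧ q x)) xs)
  length-filterᵇ² p q [] = refl
  length-filterᵇ² p q (x ∷ xs) with q x
  ... | false = trans (length-filterᵇ² p q xs) (cong (_+ _) (cong toℕ (sym (∧-zeroʳ (p x)))))
  ... | true with p x
  ...   | true  = cong suc (length-filterᵇ² p q xs)
  ...   | false = length-filterᵇ² p q xs

module _ {A B : Set} where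

  sum-map-swap : (f : A → B → ℕ) (xs : List A) (ys : List B) →
                 sum (map (λ x → sum (map (f x) ys)) xs) ≡ sum (map (λ y → sum (map (λ x → f x y) xs)) ys)
  sum-map-swap f [] ys = sym (sum-map-zero ys)
  sum-map-swap f (x ∷ xs) ys =
    trans (cong (sum (map (f x) ys) +_) (sum-map-swap f xs ys))
          (sym (sum-map-+ (f x) (λ y → sum (map (λ x → f x y) xs)) ys))

  sum-map-cartesianProduct : (f : A × B → ℕ) (xs : List A) (ys : List B) →
    sum (map f (cartesianProduct xs ys)) ≡ sum (map (λ x → sum (map (λ y → f (x , y)) ys)) xs)
  sum-map-cartesianProduct f [] ys = refl
  sum-map-cartesianProduct f (x ∷ xs) ys = begin
    sum (map f (map (x ,_) ys ++ cartesianProduct xs ys))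
      ≡⟨ cong sum (map-++ f (map (x ,_) ys) _) ⟩
    sum (map f (map (x ,_) ys) ++ map f (cartesianProduct xs ys))
      ≡⟨ sum-++ (map f (map (x ,_) ys)) _ ⟩
    sum (map f (map (x ,_) ys)) + sum (map f (cartesianProduct xs ys))
      ≡⟨ cong₂ _+_ (cong sum (sym (map-∘ ys))) (sum-map-cartesianProduct f xs ys) ⟩
    sum (map (λ y → f (x , y)) ys) + sum (map (λ x → sum (map (λ y → f (x , y)) ys)) xs) ∎

sumAll : (n : ℕ) → (Vec Bool n → ℕ) → ℕ
sumAll n f = sum (map f (allStrings n))

countAll : (n : ℕ) → (Vec Bool n → Bool) → ℕ
countAll n p = sumAll n (toℕ ∘ p)

sumAll-∷ : ∀ {n} (f : Vec Bool (suc n) → ℕ) →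
           sumAll (suc n) f ≡ sumAll n (f ∘ (false ∷_)) + sumAll n (f ∘ (true ∷_))
sumAll-∷ {n} f = begin
  sum (map f (map (false ∷_) (allStrings n) ++ map (true ∷_) (allStrings n)))
    ≡⟨ cong sum (map-++ f (map (false ∷_) (allStrings n)) _) ⟩
  sum (map f (map (false ∷_) (allStrings n)) ++ map f (map (true ∷_) (allStrings n)))
    ≡⟨ sum-++ (map f (map (false ∷_) (allStrings n))) _ ⟩
  sum (map f (map (false ∷_) (allStrings n))) + sum (map f (map (true ∷_) (allStrings n)))
    ≡⟨ cong₂ _+_ (cong sum (sym (map-∘ (allStrings n)))) (cong sum (sym (map-∘ (allStrings n)))) ⟩
  sumAll n (f ∘ (false ∷_)) + sumAll n (f ∘ (true ∷_)) ∎

sumAll-cong : ∀ {n} {f g : Vec Bool n → ℕ} → (∀ v → f v ≡ g v) → sumAll n f ≡ sumAll n g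
sumAll-cong {n} f≗g = cong sum (map-cong f≗g (allStrings n))

sumAll-+ : ∀ {n} (f g : Vec Bool n → ℕ) → sumAll n (λ v → f v + g v) ≡ sumAll n f + sumAll n g
sumAll-+ {n} f g = sum-map-+ f g (allStrings n)

countAll-cong : ∀ {n} {p q : Vec Bool n → Bool} → (∀ v → p v ≡ q v) → countAll n p ≡ countAll n q
countAll-cong p≗q = sumAll-cong (cong toℕ ∘ p≗q)

countAll-∷ : ∀ {n} (p : Vec Bool (suc n) → Bool) →
             countAll (suc n) p ≡ countAll n (p ∘ (false ∷_)) + countAll n (p ∘ (true ∷_))
countAll-∷ p = sumAll-∷ (toℕ ∘ p)

countAll-false : ∀ n → countAll n (λ _ → false) ≡ 0
countAll-false n = sum-map-zero (allStrings n)

hamming-comm : ∀ {n} (u v : Vec Bool n) → hamming u v ≡ hamming v u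
hamming-comm [] [] = refl
hamming-comm (false ∷ u) (false ∷ v) = hamming-comm u v
hamming-comm (false ∷ u) (true ∷ v) = cong suc (hamming-comm u v)
hamming-comm (true ∷ u) (false ∷ v) = cong suc (hamming-comm u v)
hamming-comm (true ∷ u) (true ∷ v) = hamming-comm u v

countAll-hamming≡0 : ∀ {n} (u : Vec Bool n) (q : Vec Bool n → Bool) →
                     countAll n (λ v → (hamming u v ≡ᵇ 0) ∧ q v) ≡ toℕ (q u)
countAll-hamming≡0 [] q = +-identityʳ (toℕ (q []))
countAll-hamming≡0 {suc n} (false ∷ u) q = begin
  countAll (suc n) (λ v → (hamming (false ∷ u) v ≡ᵇ 0) ∧ q v)
    ≡⟨ countAll-∷ (λ v → (hamming (false ∷ u) v ≡ᵇ 0) ∧ q v) ⟩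
  countAll n (λ v → (hamming u v ≡ᵇ 0) ∧ q (false ∷ v)) + countAll n (λ _ → false)
    ≡⟨ cong₂ _+_ (countAll-hamming≡0 u (q ∘ (false ∷_))) (countAll-false n) ⟩
  toℕ (q (false ∷ u)) + 0
    ≡⟨ +-identityʳ _ ⟩
  toℕ (q (false ∷ u)) ∎
countAll-hamming≡0 {suc n} (true ∷ u) q = begin
  countAll (suc n) (λ v → (hamming (true ∷ u) v ≡ᵇ 0) ∧ q v)
    ≡⟨ countAll-∷ (λ v → (hamming (true ∷ u) v ≡ᵇ 0) ∧ q v) ⟩
  countAll n (λ _ → false) + countAll n (λ v → (hamming u v ≡ᵇ 0) ∧ q (true ∷ v))
    ≡⟨ cong₂ _+_ (countAll-false n) (countAll-hamming≡0 u (q ∘ (true ∷_))) ⟩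
  toℕ (q (true ∷ u)) ∎

countAll-hamming≡0ˡ : ∀ {n} (v : Vec Bool n) (q : Vec Bool n → Bool) →
                      countAll n (λ u → (hamming u v ≡ᵇ 0) ∧ q u) ≡ toℕ (q v)
countAll-hamming≡0ˡ v q =
  trans (countAll-cong (λ u → cong (λ d → (d ≡ᵇ 0) ∧ q u) (hamming-comm u v))) (countAll-hamming≡0 v q)

neighbours : ∀ {n} → Vec Bool n → (Vec Bool n → Bool) → ℕ
neighbours {n} u q = countAll n (λ v → adjQ u v ∧ q v)

neighbours-cong : ∀ {n} (u : Vec Bool n) {q r : Vec Bool n → Bool} → (∀ v → q v ≡ r v) →
                  neighbours u q ≡ neighbours u r
neighbours-cong u q≗r = countAll-cong (λ v → cong (adjQ u v ∧_) (q≗r v))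

neighbours-∷ : ∀ {n} a (u : Vec Bool n) q →
               neighbours (a ∷ u) q ≡ neighbours u (q ∘ (a ∷_)) + toℕ (q (not a ∷ u))
neighbours-∷ false u q =
  trans (countAll-∷ (λ v → adjQ (false ∷ u) v ∧ q v)) (cong (neighbours u (q ∘ (false ∷_)) +_) (countAll-hamming≡0 u (q ∘ (true ∷_))))
neighbours-∷ true u q =
  trans (countAll-∷ (λ v → adjQ (true ∷ u) v ∧ q v)) (trans (cong (_+ neighbours u (q ∘ (true ∷_))) (countAll-hamming≡0 u (q ∘ (false ∷_))))
                            (+-comm (toℕ (q (false ∷ u))) _))

neighbours-true : ∀ {n} (u : Vec Bool n) → neighbours u (λ _ → true) ≡ n
neighbours-true [] = refl
neighbours-true {suc n} (a ∷ u) = trans (neighbours-∷ a u _) (trans (cong (_+ 1) (neighbours-true u)) (+-comm n 1))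

degBar≡neighbours : ∀ {n} (u : Vec Bool n) → degBar u ≡ neighbours u has11
degBar≡neighbours {n} u = length-filterᵇ² (adjQ u) has11 (allStrings n)

has11-0∷ : ∀ {n} (u : Vec Bool n) → has11 (false ∷ u) ≡ has11 u
has11-0∷ [] = refl
has11-0∷ (_ ∷ _) = refl

has11-10∷ : ∀ {n} (u : Vec Bool n) → has11 (true ∷ false ∷ u) ≡ has11 u
has11-10∷ = has11-0∷

has11-∷ : ∀ {n} a (u : Vec Bool n) → T (has11 u) → T (has11 (a ∷ u))
has11-∷ a (b ∷ u) h with a ∧ b
... | true  = _
... | false = h

degBar-0∷ : ∀ {n} (u : Vec Bool n) → degBar (false ∷ u) ≡ degBar u + toℕ (has11 (true ∷ u))
degBar-0∷ u = begin
  degBar (false ∷ u)                                       ≡⟨ degBar≡neighbours (false ∷ u) ⟩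
  neighbours (false ∷ u) has11                             ≡⟨ neighbours-∷ false u has11 ⟩
  neighbours u (has11 ∘ (false ∷_)) + toℕ (has11 (true ∷ u)) ≡⟨ cong (_+ toℕ (has11 (true ∷ u))) (neighbours-cong u has11-0∷) ⟩
  neighbours u has11 + toℕ (has11 (true ∷ u))              ≡⟨ cong (_+ toℕ (has11 (true ∷ u))) (degBar≡neighbours u) ⟨
  degBar u + toℕ (has11 (true ∷ u))                        ∎

degBar-10∷ : ∀ {n} (u : Vec Bool n) → degBar (true ∷ false ∷ u) ≡ degBar u + 1 + toℕ (has11 u)
degBar-10∷ u = begin
  degBar (true ∷ false ∷ u)
    ≡⟨ degBar≡neighbours (true ∷ false ∷ u) ⟩
  neighbours (true ∷ false ∷ u) has11
    ≡⟨ neighbours-∷ true (false ∷ u) has11 ⟩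
  neighbours (false ∷ u) (has11 ∘ (true ∷_)) + toℕ (has11 (false ∷ u))
    ≡⟨ cong₂ _+_ (neighbours-∷ false u (has11 ∘ (true ∷_))) (cong toℕ (has11-0∷ u)) ⟩
  neighbours u (has11 ∘ (true ∷_) ∘ (false ∷_)) + 1 + toℕ (has11 u)
    ≡⟨ cong (λ d → d + 1 + toℕ (has11 u)) (neighbours-cong u has11-10∷) ⟩
  neighbours u has11 + 1 + toℕ (has11 u)
    ≡⟨ cong (λ d → d + 1 + toℕ (has11 u)) (degBar≡neighbours u) ⟨
  degBar u + 1 + toℕ (has11 u) ∎

degBar-11∷ : ∀ {n} (u : Vec Bool n) → degBar (true ∷ true ∷ u) ≡ n + toℕ (has11 u) + toℕ (has11 (true ∷ u))
degBar-11∷ {n} u = begin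
  degBar (true ∷ true ∷ u)
    ≡⟨ degBar≡neighbours (true ∷ true ∷ u) ⟩
  neighbours (true ∷ true ∷ u) has11
    ≡⟨ neighbours-∷ true (true ∷ u) has11 ⟩
  neighbours (true ∷ u) (has11 ∘ (true ∷_)) + toℕ (has11 (true ∷ u))
    ≡⟨ cong (_+ toℕ (has11 (true ∷ u))) (neighbours-∷ true u (has11 ∘ (true ∷_))) ⟩
  neighbours u (λ _ → true) + toℕ (has11 (true ∷ false ∷ u)) + toℕ (has11 (true ∷ u))
    ≡⟨ cong₂ (λ d e → d + toℕ e + toℕ (has11 (true ∷ u))) (neighbours-true u) (has11-10∷ u) ⟩
  n + toℕ (has11 u) + toℕ (has11 (true ∷ u)) ∎

-- The shape of a string, computed from the right: its kind is pair (resp. triple) when its runs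
-- of 1s of length ≥ 2 reduce to a single run of length exactly 2 (resp. 3), fibonacci when there
-- is no such run and full otherwise; its start tells whether it begins with 0 (or is empty), with
-- 1 (outside the run, for pair and triple), or with the run itself.
data Kind : Set where
  fibonacci full triple pair : Kind

data Start : Kind → Set where
  0⋯ 1⋯ : ∀ {k} → Start k
  11⋯   : Start pair
  111⋯  : Start triple

Shape : Set
Shape = Σ Kind Start

prepend : Bool → Shape → Shape
prepend false (k , _)            = k , 0⋯
prepend true (fibonacci , 0⋯)    = fibonacci , 1⋯
prepend true (fibonacci , 1⋯)    = pair , 11⋯
prepend true (full , _)          = full , 1⋯
prepend true (triple , 0⋯)       = triple , 1⋯
prepend true (triple , 1⋯)       = full , 1⋯
prepend true (triple , 111⋯)     = full , 1⋯
prepend true (pair , 0⋯)         = pair , 1⋯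
prepend true (pair , 1⋯)         = full , 1⋯
prepend true (pair , 11⋯)        = triple , 111⋯

shape : ∀ {n} → Vec Bool n → Shape
shape [] = fibonacci , 0⋯
shape (a ∷ u) = prepend a (shape u)

kind : ∀ {n} → Vec Bool n → Kind
kind u = proj₁ (shape u)

has11ᵏ : Kind → Bool
has11ᵏ fibonacci = false
has11ᵏ _ = true

-- Fibonacci strings are not vertices of Γ̄_n.
defect : Kind → ℕ
defect fibonacci = 0
defect full = 0
defect triple = 1
defect pair = 2

kind-10∷ : ∀ k → proj₁ (prepend true (k , 0⋯)) ≡ k
kind-10∷ fibonacci = refl
kind-10∷ full = refl
kind-10∷ triple = refl
kind-10∷ pair = refl

has11ᵏ-11∷ : ∀ s → has11ᵏ (proj₁ (prepend true (prepend true s))) ≡ true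
has11ᵏ-11∷ (fibonacci , 0⋯) = refl
has11ᵏ-11∷ (fibonacci , 1⋯) = refl
has11ᵏ-11∷ (full , 0⋯) = refl
has11ᵏ-11∷ (full , 1⋯) = refl
has11ᵏ-11∷ (triple , 0⋯) = refl
has11ᵏ-11∷ (triple , 1⋯) = refl
has11ᵏ-11∷ (triple , 111⋯) = refl
has11ᵏ-11∷ (pair , 0⋯) = refl
has11ᵏ-11∷ (pair , 1⋯) = refl
has11ᵏ-11∷ (pair , 11⋯) = refl

defect-11∷ : ∀ s → toℕ (has11ᵏ (proj₁ s)) + toℕ (has11ᵏ (proj₁ (prepend true s)))
                   + defect (proj₁ (prepend true (prepend true s))) ≡ 2
defect-11∷ (fibonacci , 0⋯) = refl
defect-11∷ (fibonacci , 1⋯) = refl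
defect-11∷ (full , 0⋯) = refl
defect-11∷ (full , 1⋯) = refl
defect-11∷ (triple , 0⋯) = refl
defect-11∷ (triple , 1⋯) = refl
defect-11∷ (triple , 111⋯) = refl
defect-11∷ (pair , 0⋯) = refl
defect-11∷ (pair , 1⋯) = refl
defect-11∷ (pair , 11⋯) = refl

has11≡has11ᵏ : ∀ {n} (u : Vec Bool n) → has11 u ≡ has11ᵏ (kind u)
has11≡has11ᵏ [] = refl
has11≡has11ᵏ (false ∷ u) = trans (has11-0∷ u) (has11≡has11ᵏ u)
has11≡has11ᵏ (true ∷ []) = refl
has11≡has11ᵏ (true ∷ false ∷ u) =
  trans (has11-10∷ u) (trans (has11≡has11ᵏ u) (cong has11ᵏ (sym (kind-10∷ (kind u)))))
has11≡has11ᵏ (true ∷ true ∷ u) = sym (has11ᵏ-11∷ (shape u))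

degBar+defect : ∀ {n} (u : Vec Bool n) → T (has11 u) → degBar u + defect (kind u) ≡ n
degBar+defect (false ∷ u) h = begin
  degBar (false ∷ u) + defect (kind u)                   ≡⟨ cong (_+ defect (kind u)) (degBar-0∷ u) ⟩
  degBar u + toℕ (has11 (true ∷ u)) + defect (kind u)    ≡⟨ cong (λ b → degBar u + b + defect (kind u)) (toℕ-T (has11-∷ true u h′)) ⟩
  degBar u + 1 + defect (kind u)                         ≡⟨ +-assoc (degBar u) 1 _ ⟩
  degBar u + suc (defect (kind u))                       ≡⟨ +-suc (degBar u) _ ⟩
  suc (degBar u + defect (kind u))                       ≡⟨ cong suc (degBar+defect u h′) ⟩
  _ ∎
  where
  h′ : T (has11 u)
  h′ = subst T (has11-0∷ u) h
degBar+defect (true ∷ false ∷ u) h = begin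
  degBar (true ∷ false ∷ u) + defect (kind (true ∷ false ∷ u)) ≡⟨ cong₂ _+_ (degBar-10∷ u) (cong defect (kind-10∷ (kind u))) ⟩
  degBar u + 1 + toℕ (has11 u) + defect (kind u)               ≡⟨ cong (λ b → degBar u + 1 + b + defect (kind u)) (toℕ-T h′) ⟩
  degBar u + 1 + 1 + defect (kind u)                           ≡⟨ shift (degBar u) (defect (kind u)) ⟩
  suc (suc (degBar u + defect (kind u)))                       ≡⟨ cong (suc ∘ suc) (degBar+defect u h′) ⟩
  _ ∎
  where
  h′ : T (has11 u)
  h′ = subst T (has11-10∷ u) h
  shift : ∀ d e → d + 1 + 1 + e ≡ suc (suc (d + e))
  shift = solve-∀
degBar+defect {suc (suc n)} (true ∷ true ∷ u) _ = begin
  degBar (true ∷ true ∷ u) + defect (kind (true ∷ true ∷ u))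
    ≡⟨ cong (_+ defect (kind (true ∷ true ∷ u))) (degBar-11∷ u) ⟩
  n + toℕ (has11 u) + toℕ (has11 (true ∷ u)) + defect (kind (true ∷ true ∷ u))
    ≡⟨ cong₂ (λ b c → n + toℕ b + toℕ c + defect (kind (true ∷ true ∷ u))) (has11≡has11ᵏ u) (has11≡has11ᵏ (true ∷ u)) ⟩
  n + toℕ (has11ᵏ (kind u)) + toℕ (has11ᵏ (kind (true ∷ u))) + defect (kind (true ∷ true ∷ u))
    ≡⟨ regroup n _ _ _ ⟩
  n + (toℕ (has11ᵏ (kind u)) + toℕ (has11ᵏ (kind (true ∷ u))) + defect (kind (true ∷ true ∷ u)))
    ≡⟨ cong (n +_) (defect-11∷ (shape u)) ⟩
  n + 2
    ≡⟨ +-comm n 2 ⟩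
  suc (suc n) ∎
  where
  regroup : ∀ m a b c → m + a + b + c ≡ m + (a + b + c)
  regroup = solve-∀

degBar≡∸defect : ∀ {n} (u : Vec Bool n) → T (has11 u) → degBar u ≡ n ∸ defect (kind u)
degBar≡∸defect u h =
  trans (sym (m+n∸n≡m (degBar u) (defect (kind u)))) (cong (_∸ defect (kind u)) (degBar+defect u h))

degBar-cases : ∀ {n} (u : Vec Bool n) → T (has11 u) → (degBar u ≡ n) ⊎ (degBar u ≡ n ∸ 1) ⊎ (degBar u ≡ n ∸ 2)
degBar-cases {n} u h =
  Sum.map (trans degBar≡) (Sum.map (trans degBar≡) (trans degBar≡)) (by-kind (kind u) (subst T (has11≡has11ᵏ u) h))
  where
  degBar≡ : degBar u ≡ n ∸ defect (kind u)
  degBar≡ = degBar≡∸defect u h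
  by-kind : ∀ k → T (has11ᵏ k) → (n ∸ defect k ≡ n) ⊎ (n ∸ defect k ≡ n ∸ 1) ⊎ (n ∸ defect k ≡ n ∸ 2)
  by-kind full _ = inj₁ refl
  by-kind triple _ = inj₂ (inj₁ refl)
  by-kind pair _ = inj₂ (inj₂ refl)

hasDefect : ℕ → Kind → Bool
hasDefect j k = (defect k ≡ᵇ j) ∧ has11ᵏ k

countDeg-∸ : ∀ {n j} → j ≤ n → countDeg n (n ∸ j) ≡ countAll n (hasDefect j ∘ kind)
countDeg-∸ {n} {j} j≤n = trans (length-filterᵇ² (λ u → degBar u ≡ᵇ n ∸ j) has11 (allStrings n)) (countAll-cong same)
  where
  same : ∀ u → (degBar u ≡ᵇ n ∸ j) ∧ has11 u ≡ hasDefect j (kind u)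
  same u = trans (∧-congʳ-T (has11 u) by-degree) (cong ((defect (kind u) ≡ᵇ j) ∧_) (has11≡has11ᵏ u))
    where
    by-degree : T (has11 u) → (degBar u ≡ᵇ n ∸ j) ≡ (defect (kind u) ≡ᵇ j)
    by-degree h = begin
      (degBar u ≡ᵇ n ∸ j)             ≡⟨ cong (_≡ᵇ n ∸ j) (degBar≡∸defect u h) ⟩
      (n ∸ defect (kind u) ≡ᵇ n ∸ j)  ≡⟨ ∸-≡ᵇ-∸ (subst (defect (kind u) ≤_) (degBar+defect u h) (m≤n+m _ _)) j≤n ⟩
      (defect (kind u) ≡ᵇ j)          ∎

Σᵏ : (Kind → ℕ) → ℕ
Σᵏ f = f fibonacci + (f full + (f triple + f pair))

total : (Shape → ℕ) → Kind → ℕ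
total W fibonacci = W (fibonacci , 0⋯) + W (fibonacci , 1⋯)
total W full      = W (full , 0⋯) + W (full , 1⋯)
total W triple    = W (triple , 0⋯) + W (triple , 1⋯) + W (triple , 111⋯)
total W pair      = W (pair , 0⋯) + W (pair , 1⋯) + W (pair , 11⋯)

weigh : (Shape → Bool) → (Shape → ℕ) → ℕ
weigh g W = Σᵏ (total (λ s → toℕ (g s) * W s))

-- transfer W s sums W over the shapes t with prepend b t ≡ s for some letter b.
transfer : (Shape → ℕ) → Shape → ℕ
transfer W (k , 0⋯)          = total W k
transfer W (fibonacci , 1⋯)  = W (fibonacci , 0⋯)
transfer W (full , 1⋯)       = total W full + W (pair , 1⋯) + W (triple , 1⋯) + W (triple , 111⋯)
transfer W (triple , 1⋯)     = W (triple , 0⋯)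
transfer W (triple , 111⋯)   = W (pair , 11⋯)
transfer W (pair , 1⋯)       = W (pair , 0⋯)
transfer W (pair , 11⋯)      = W (fibonacci , 1⋯)

census : ℕ → Shape → ℕ
census zero (fibonacci , 0⋯) = 1
census zero _                = 0
census (suc n)               = transfer (census n)

population : ℕ → Kind → ℕ
population n = total (census n)

weigh-transfer : ∀ g W → weigh (g ∘ prepend false) W + weigh (g ∘ prepend true) W ≡ weigh g (transfer W)
weigh-transfer g W =
  identity (c (fibonacci , 0⋯)) (c (fibonacci , 1⋯)) (c (full , 0⋯)) (c (full , 1⋯))
           (c (triple , 0⋯)) (c (triple , 1⋯)) (c (triple , 111⋯)) (c (pair , 0⋯)) (c (pair , 1⋯)) (c (pair , 11⋯))
           (W (fibonacci , 0⋯)) (W (fibonacci , 1⋯)) (W (full , 0⋯)) (W (full , 1⋯))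
           (W (triple , 0⋯)) (W (triple , 1⋯)) (W (triple , 111⋯)) (W (pair , 0⋯)) (W (pair , 1⋯)) (W (pair , 11⋯))
  where
  c : Shape → ℕ
  c = toℕ ∘ g
  identity : ∀ c₀ c₁ c₂ c₃ c₄ c₅ c₆ c₇ c₈ c₉ v₀ v₁ v₂ v₃ v₄ v₅ v₆ v₇ v₈ v₉ →
    (c₀ * v₀ + c₀ * v₁) + ((c₂ * v₂ + c₂ * v₃) + ((c₄ * v₄ + c₄ * v₅ + c₄ * v₆) + (c₇ * v₇ + c₇ * v₈ + c₇ * v₉)))
    + ((c₁ * v₀ + c₉ * v₁) + ((c₃ * v₂ + c₃ * v₃) + ((c₅ * v₄ + c₃ * v₅ + c₃ * v₆) + (c₈ * v₇ + c₃ * v₈ + c₆ * v₉))))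
    ≡ (c₀ * (v₀ + v₁) + c₁ * v₀)
      + ((c₂ * (v₂ + v₃) + c₃ * ((v₂ + v₃) + v₈ + v₅ + v₆))
      + ((c₄ * (v₄ + v₅ + v₆) + c₅ * v₄ + c₆ * v₉) + (c₇ * (v₇ + v₈ + v₉) + c₈ * v₇ + c₉ * v₁)))
  identity = solve-∀

countAll-shape : ∀ n (g : Shape → Bool) → countAll n (g ∘ shape) ≡ weigh g (census n)
countAll-shape zero g = identity (c (fibonacci , 0⋯)) (c (fibonacci , 1⋯)) (c (full , 0⋯)) (c (full , 1⋯))
                                  (c (triple , 0⋯)) (c (triple , 1⋯)) (c (triple , 111⋯))
                                  (c (pair , 0⋯)) (c (pair , 1⋯)) (c (pair , 11⋯))
  where
  c : Shape → ℕ
  c = toℕ ∘ g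
  identity : ∀ c₀ c₁ c₂ c₃ c₄ c₅ c₆ c₇ c₈ c₉ →
    c₀ + 0 ≡ (c₀ * 1 + c₁ * 0) + ((c₂ * 0 + c₃ * 0) + ((c₄ * 0 + c₅ * 0 + c₆ * 0) + (c₇ * 0 + c₈ * 0 + c₉ * 0)))
  identity = solve-∀
countAll-shape (suc n) g = begin
  countAll (suc n) (g ∘ shape)
    ≡⟨ countAll-∷ {n} (g ∘ shape) ⟩
  countAll n (g ∘ prepend false ∘ shape) + countAll n (g ∘ prepend true ∘ shape)
    ≡⟨ cong₂ _+_ (countAll-shape n (g ∘ prepend false)) (countAll-shape n (g ∘ prepend true)) ⟩
  weigh (g ∘ prepend false) (census n) + weigh (g ∘ prepend true) (census n)
    ≡⟨ weigh-transfer g (census n) ⟩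
  weigh g (census (suc n)) ∎

Σᵏ-cong : ∀ {f g : Kind → ℕ} → (∀ k → f k ≡ g k) → Σᵏ f ≡ Σᵏ g
Σᵏ-cong f≗g = cong₂ _+_ (f≗g fibonacci) (cong₂ _+_ (f≗g full) (cong₂ _+_ (f≗g triple) (f≗g pair)))

total-*ᵏ : ∀ (h : Kind → ℕ) W k → total (λ s → h (proj₁ s) * W s) k ≡ h k * total W k
total-*ᵏ h W fibonacci = sym (*-distribˡ-+ (h fibonacci) _ _)
total-*ᵏ h W full      = sym (*-distribˡ-+ (h full) _ _)
total-*ᵏ h W triple    =
  sym (trans (*-distribˡ-+ (h triple) _ _) (cong (_+ h triple * W (triple , 111⋯)) (*-distribˡ-+ (h triple) (W (triple , 0⋯)) _)))
total-*ᵏ h W pair      =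
  sym (trans (*-distribˡ-+ (h pair) _ _) (cong (_+ h pair * W (pair , 11⋯)) (*-distribˡ-+ (h pair) (W (pair , 0⋯)) _)))

countAll-kind : ∀ n (h : Kind → Bool) → countAll n (h ∘ kind) ≡ Σᵏ (λ k → toℕ (h k) * population n k)
countAll-kind n h = trans (countAll-shape n (h ∘ proj₁)) (Σᵏ-cong (total-*ᵏ (toℕ ∘ h) (census n)))

countAll-fib : ∀ n → countAll n fib ≡ population n fibonacci
countAll-fib n = begin
  countAll n fib                                                  ≡⟨ countAll-cong {n} (cong not ∘ has11≡has11ᵏ) ⟩
  countAll n (not ∘ has11ᵏ ∘ kind)                                ≡⟨ countAll-kind n (not ∘ has11ᵏ) ⟩
  population n fibonacci + 0 + 0                                  ≡⟨ cong (_+ 0) (+-identityʳ _) ⟩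
  population n fibonacci + 0                                      ≡⟨ +-identityʳ _ ⟩
  population n fibonacci                                          ∎

countDeg-class : ∀ {n} k → T (has11ᵏ k) → 2 ≤ n → countDeg n (n ∸ defect k) ≡ population n k
countDeg-class {n} full _ _ =
  trans (countDeg-∸ {n} z≤n) (trans (countAll-kind n (hasDefect 0)) (trans (cong (_+ 0) (+-identityʳ _)) (+-identityʳ _)))
countDeg-class {n} triple _ 2≤n =
  trans (countDeg-∸ {n} (≤-trans (s≤s z≤n) 2≤n)) (trans (countAll-kind n (hasDefect 1)) (trans (cong (_+ 0) (+-identityʳ _)) (+-identityʳ _)))
countDeg-class {n} pair _ 2≤n =
  trans (countDeg-∸ {n} 2≤n) (trans (countAll-kind n (hasDefect 2)) (+-identityʳ _))

fib-0∷ : ∀ {n} (v : Vec Bool n) → fib (false ∷ v) ≡ fib v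
fib-0∷ v = cong not (has11-0∷ v)

ones : ∀ {n} → Vec Bool n → ℕ
ones [] = 0
ones (b ∷ v) = toℕ b + ones v

markedFib : ℕ → ℕ
markedFib n = sumAll n (λ v → toℕ (fib v) * ones v)

markedFib-suc-suc : ∀ n → markedFib (2 + n) ≡ markedFib (1 + n) + markedFib n + population n fibonacci
markedFib-suc-suc n = begin
  markedFib (2 + n)
    ≡⟨ sumAll-∷ {1 + n} f ⟩
  sumAll (1 + n) (f ∘ (false ∷_)) + sumAll (1 + n) (f ∘ (true ∷_))
    ≡⟨ cong₂ _+_ (sumAll-cong {1 + n} (λ v → cong (λ b → toℕ b * ones v) (fib-0∷ v))) (sumAll-∷ {n} (f ∘ (true ∷_))) ⟩
  markedFib (1 + n) + (sumAll n (λ v → toℕ (fib (false ∷ v)) * suc (ones v)) + sumAll n (λ _ → 0))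
    ≡⟨ cong (λ m → markedFib (1 + n) + (m + sumAll n (λ _ → 0))) (sumAll-cong {n} one-more) ⟩
  markedFib (1 + n) + (sumAll n (λ v → toℕ (fib v) + toℕ (fib v) * ones v) + sumAll n (λ _ → 0))
    ≡⟨ cong₂ (λ a b → markedFib (1 + n) + (a + b)) (sumAll-+ {n} (toℕ ∘ fib) (λ v → toℕ (fib v) * ones v)) (sum-map-zero (allStrings n)) ⟩
  markedFib (1 + n) + (countAll n fib + markedFib n + 0)
    ≡⟨ cong (λ c → markedFib (1 + n) + (c + markedFib n + 0)) (countAll-fib n) ⟩
  markedFib (1 + n) + (population n fibonacci + markedFib n + 0)
    ≡⟨ rearrange (markedFib (1 + n)) (population n fibonacci) (markedFib n) ⟩
  markedFib (1 + n) + markedFib n + population n fibonacci ∎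
  where
  f : Vec Bool (2 + n) → ℕ
  f v = toℕ (fib v) * ones v
  one-more : ∀ v → toℕ (fib (false ∷ v)) * suc (ones v) ≡ toℕ (fib v) + toℕ (fib v) * ones v
  one-more v = trans (cong (λ b → toℕ b * suc (ones v)) (fib-0∷ v)) (*-suc (toℕ (fib v)) (ones v))
  rearrange : ∀ a b c → a + (b + c + 0) ≡ a + c + b
  rearrange = solve-∀

markedFib-unique : (x : ℕ → ℕ) → x 0 ≡ 0 → x 1 ≡ 1 →
                   (∀ n → x (2 + n) ≡ x (1 + n) + x n + population n fibonacci) →
                   ∀ n → x n ≡ markedFib n
markedFib-unique x x₀ x₁ step zero = x₀
markedFib-unique x x₀ x₁ step (suc zero) = x₁
markedFib-unique x x₀ x₁ step (suc (suc n)) = begin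
  x (2 + n)                                                ≡⟨ step n ⟩
  x (1 + n) + x n + population n fibonacci                 ≡⟨ cong₂ (λ a b → a + b + population n fibonacci) (markedFib-unique x x₀ x₁ step (suc n)) (markedFib-unique x x₀ x₁ step n) ⟩
  markedFib (1 + n) + markedFib n + population n fibonacci ≡⟨ markedFib-suc-suc n ⟨
  markedFib (2 + n)                                        ∎

population-pair : ∀ n → population (1 + n) pair ≡ markedFib n
population-pair = markedFib-unique (λ n → population (1 + n) pair) refl refl (λ _ → refl)

population-triple : ∀ n → population (2 + n) triple ≡ markedFib n
population-triple = markedFib-unique (λ n → population (2 + n) triple) refl refl (λ _ → refl)

population-full-suc : ∀ n → population (suc n) full ≡
                      2 * population n full + (census n (pair , 1⋯) + census n (triple , 1⋯) + census n (triple , 111⋯))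
population-full-suc n = identity (population n full) (census n (pair , 1⋯)) (census n (triple , 1⋯)) (census n (triple , 111⋯))
  where
  identity : ∀ p a b c → p + (p + a + b + c) ≡ 2 * p + (a + b + c)
  identity = solve-∀

inflow-full : ∀ m → census (3 + m) (pair , 1⋯) + census (3 + m) (triple , 1⋯) + census (3 + m) (triple , 111⋯) ≡ markedFib (1 + m)
inflow-full zero = refl
inflow-full (suc m) = begin
  population (2 + m) pair + population (2 + m) triple + population m fibonacci
    ≡⟨ cong₂ (λ a b → a + b + population m fibonacci) (population-pair (1 + m)) (population-triple m) ⟩
  markedFib (1 + m) + markedFib m + population m fibonacci
    ≡⟨ markedFib-suc-suc m ⟨
  markedFib (2 + m) ∎

sumBelow-suc : ∀ K f → sumBelow (suc K) f ≡ f 0 + sumBelow K (f ∘ suc)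
sumBelow-suc K f = cong (f 0 +_) (cong sum (trans (map-applyUpTo suc f K) (sym (map-applyUpTo (λ k → k) (f ∘ suc) K))))

sumBelow-cong : ∀ K {f g : ℕ → ℕ} → (∀ k → f k ≡ g k) → sumBelow K f ≡ sumBelow K g
sumBelow-cong K f≗g = cong sum (map-cong f≗g (upTo K))

sumBelow-*ˡ : ∀ K c f → sumBelow K (λ k → c * f k) ≡ c * sumBelow K f
sumBelow-*ˡ K c f = sum-map-*ˡ c f (upTo K)

population-full : ∀ j → population (3 + j) full ≡ sumBelow j (λ k → 2 ^ k * markedFib (j ∸ k))
population-full zero = refl
population-full (suc j) = begin
  population (4 + j) full
    ≡⟨ population-full-suc (3 + j) ⟩
  2 * population (3 + j) full + (census (3 + j) (pair , 1⋯) + census (3 + j) (triple , 1⋯) + census (3 + j) (triple , 111⋯))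
    ≡⟨ cong₂ (λ a b → 2 * a + b) (population-full j) (inflow-full j) ⟩
  2 * sumBelow j (λ k → 2 ^ k * markedFib (j ∸ k)) + markedFib (1 + j)
    ≡⟨ +-comm _ (markedFib (1 + j)) ⟩
  markedFib (1 + j) + 2 * sumBelow j (λ k → 2 ^ k * markedFib (j ∸ k))
    ≡⟨ cong₂ _+_ (+-identityʳ _) (sumBelow-*ˡ j 2 (λ k → 2 ^ k * markedFib (j ∸ k))) ⟨
  markedFib (1 + j) + 0 + sumBelow j (λ k → 2 * (2 ^ k * markedFib (j ∸ k)))
    ≡⟨ cong (markedFib (1 + j) + 0 +_) (sumBelow-cong j (λ k → *-assoc 2 (2 ^ k) _)) ⟨
  2 ^ 0 * markedFib (suc j) + sumBelow j (λ k → 2 ^ suc k * markedFib (suc j ∸ suc k))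
    ≡⟨ sumBelow-suc j (λ k → 2 ^ k * markedFib (suc j ∸ k)) ⟨
  sumBelow (suc j) (λ k → 2 ^ k * markedFib (suc j ∸ k)) ∎

lowerNeighbours : ∀ {n} → Vec Bool n → (Vec Bool n → Bool) → ℕ
lowerNeighbours {n} v q = countAll n (λ u → adjQ u v ∧ (lexLt u v ∧ q u))

lowerNeighbours-cong : ∀ {n} (v : Vec Bool n) {q r : Vec Bool n → Bool} → (∀ u → q u ≡ r u) →
                       lowerNeighbours v q ≡ lowerNeighbours v r
lowerNeighbours-cong {n} v q≗r = countAll-cong {n} (λ u → cong (λ b → adjQ u v ∧ (lexLt u v ∧ b)) (q≗r u))

lowerNeighbours-0∷ : ∀ {n} (v : Vec Bool n) q → lowerNeighbours (false ∷ v) q ≡ lowerNeighbours v (q ∘ (false ∷_))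
lowerNeighbours-0∷ {n} v q = begin
  lowerNeighbours (false ∷ v) q
    ≡⟨ countAll-∷ {n} (λ u → adjQ u (false ∷ v) ∧ (lexLt u (false ∷ v) ∧ q u)) ⟩
  lowerNeighbours v (q ∘ (false ∷_)) + countAll n (λ u → (hamming u v ≡ᵇ 0) ∧ false)
    ≡⟨ cong (lowerNeighbours v (q ∘ (false ∷_)) +_) (countAll-hamming≡0ˡ v (λ _ → false)) ⟩
  lowerNeighbours v (q ∘ (false ∷_)) + 0
    ≡⟨ +-identityʳ _ ⟩
  lowerNeighbours v (q ∘ (false ∷_)) ∎

lowerNeighbours-1∷ : ∀ {n} (v : Vec Bool n) q →
                     lowerNeighbours (true ∷ v) q ≡ toℕ (q (false ∷ v)) + lowerNeighbours v (q ∘ (true ∷_))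
lowerNeighbours-1∷ {n} v q =
  trans (countAll-∷ {n} (λ u → adjQ u (true ∷ v) ∧ (lexLt u (true ∷ v) ∧ q u)))
        (cong (_+ lowerNeighbours v (q ∘ (true ∷_))) (countAll-hamming≡0ˡ v (q ∘ (false ∷_))))

lowerNeighbours-fib : ∀ {n} (v : Vec Bool n) → T (fib v) → lowerNeighbours v fib ≡ ones v
lowerNeighbours-fib [] _ = refl
lowerNeighbours-fib (false ∷ v) h = begin
  lowerNeighbours (false ∷ v) fib      ≡⟨ lowerNeighbours-0∷ v fib ⟩
  lowerNeighbours v (fib ∘ (false ∷_)) ≡⟨ lowerNeighbours-cong v fib-0∷ ⟩
  lowerNeighbours v fib                ≡⟨ lowerNeighbours-fib v (subst T (fib-0∷ v) h) ⟩
  ones v                               ∎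
lowerNeighbours-fib (true ∷ []) _ = refl
lowerNeighbours-fib (true ∷ false ∷ v) h = begin
  lowerNeighbours (true ∷ false ∷ v) fib
    ≡⟨ lowerNeighbours-1∷ (false ∷ v) fib ⟩
  toℕ (fib (false ∷ v)) + lowerNeighbours (false ∷ v) (fib ∘ (true ∷_))
    ≡⟨ cong₂ _+_ (toℕ-T h) (lowerNeighbours-0∷ v (fib ∘ (true ∷_))) ⟩
  1 + lowerNeighbours v (fib ∘ (true ∷_) ∘ (false ∷_))
    ≡⟨ cong (1 +_) (lowerNeighbours-cong v fib-0∷) ⟩
  1 + lowerNeighbours v fib
    ≡⟨ cong (1 +_) (lowerNeighbours-fib v (subst T (fib-0∷ v) h)) ⟩
  1 + ones v ∎

edgesFib≡markedFib : ∀ m → edgesFib m ≡ markedFib m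
edgesFib≡markedFib m = begin
  edgesFib m
    ≡⟨ length-filterᵇ _ (cartesianProduct (allStrings m) (allStrings m)) ⟩
  sum (map (λ (u , v) → toℕ (edge u v)) (cartesianProduct (allStrings m) (allStrings m)))
    ≡⟨ sum-map-cartesianProduct (λ (u , v) → toℕ (edge u v)) (allStrings m) (allStrings m) ⟩
  sumAll m (λ u → countAll m (λ v → edge u v))
    ≡⟨ sum-map-swap (λ u v → toℕ (edge u v)) (allStrings m) (allStrings m) ⟩
  sumAll m (λ v → countAll m (λ u → edge u v))
    ≡⟨ sumAll-cong {m} lower-edges ⟩
  markedFib m ∎
  where
  edge : Vec Bool m → Vec Bool m → Bool
  edge u v = fib u ∧ fib v ∧ adjQ u v ∧ lexLt u v
  lower-edges : ∀ v → countAll m (λ u → edge u v) ≡ toℕ (fib v) * ones v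
  lower-edges v with fib v in fib-v
  ... | false = trans (countAll-cong {m} (λ u → ∧-zeroʳ (fib u))) (countAll-false m)
  ... | true = begin
    countAll m (λ u → fib u ∧ adjQ u v ∧ lexLt u v)
      ≡⟨ countAll-cong {m} (λ u → trans (∧-comm (fib u) _) (∧-assoc (adjQ u v) (lexLt u v) (fib u))) ⟩
    lowerNeighbours v fib
      ≡⟨ lowerNeighbours-fib v (subst T (sym fib-v) _) ⟩
    ones v
      ≡⟨ +-identityʳ (ones v) ⟨
    ones v + 0 ∎

population-full-edgesFib : ∀ i → population (2 + i) full ≡ sumBelow (2 + i ∸ 3) (λ k → 2 ^ k * edgesFib (2 + i ∸ k ∸ 3))
population-full-edgesFib zero = refl
population-full-edgesFib (suc j) =
  trans (population-full j) (sumBelow-cong j (λ k → cong (2 ^ k *_) (sym (edgesFib-shift k))))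
  where
  edgesFib-shift : ∀ k → edgesFib (3 + j ∸ k ∸ 3) ≡ markedFib (j ∸ k)
  edgesFib-shift k =
    trans (cong edgesFib (trans (∸-+-assoc (3 + j) k 3) (cong (3 + j ∸_) (+-comm k 3)))) (edgesFib≡markedFib (j ∸ k))

mainTheorem16 : (n : ℕ) → 2 ≤ n →
      ((u : Vec Bool n) → T (has11 u) →
        (degBar u ≡ n) ⊎ (degBar u ≡ n ∸ 1) ⊎ (degBar u ≡ n ∸ 2))
    × (countDeg n (n ∸ 2) ≡ edgesFib (n ∸ 1))
    × (countDeg n (n ∸ 1) ≡ edgesFib (n ∸ 2))
    × (countDeg n n ≡ sumBelow (n ∸ 3) (λ k → 2 ^ k * edgesFib (n ∸ k ∸ 3)))
mainTheorem16 (suc zero) (s≤s ())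
mainTheorem16 (suc (suc m)) 2≤n =
    degBar-cases
  , trans (countDeg-class pair _ 2≤n) (trans (population-pair (suc m)) (sym (edgesFib≡markedFib (suc m))))
  , trans (countDeg-class triple _ 2≤n) (trans (population-triple m) (sym (edgesFib≡markedFib m)))
  , trans (countDeg-class full _ 2≤n) (population-full-edgesFib m)
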